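{- Let $G=(V,E)$ be a finite, simple, connected graph that is claw-free and AT-free. Then the last vertex of any BFS order of $G$ (started at an arbitrary vertex) is admissible.
   Context: A graph is claw-free if it has no induced $K_{1,3}$. An asteroidal triple is an independent set of three vertices such that for any two of them there is a path between them containing no neighbour of the third; $G$ is AT-free if it has none. A path $P$ avoids a vertex $v$ if $v$ has no neighbour on $P$. The domination betweenness $\mathcal{B}_D(G)$ is the set of triples $(x,y,z)$ of distinct vertices such that there is a chordless $x$-$y$-path avoiding $z$ and a chordless $y$-$z$-path avoiding $x$. A vertex $y$ is admissible if there are no $x,z$ with $(x,y,z)\in\mathcal{B}_D(G)$. A BFS order is an ordering of $V$ produced by a breadth-first search with arbitrary tie-breaking. -}

module Defs where

open import Data.Nat using (ℕ; suc; _+_; _≤_; _<_)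
open import Data.Fin using (Fin; toℕ)
open import Data.List using (List; []; _∷_; _++_; length; lookup; head; last)
open import Data.List.Membership.Propositional using (_∈_; _∉_)
open import Data.List.Relation.Unary.All using (All)
open import Data.List.Relation.Unary.Linked using (Linked)
open import Data.List.Relation.Unary.Unique.Propositional using (Unique)
open import Data.Maybe using (just)
open import Data.Product using (Σ; _×_; ∃; ∃-syntax; _,_)
open import Data.Empty using (⊥)
open import Relation.Nullary using (¬_; Dec)
open import Relation.Binary.PropositionalEquality using (_≡_; _≢_)
open import Function.Bundles using (_⇔_)

record Graph : Set₁ where
  field
    n     : ℕ
    Adj   : Fin n → Fin n → Set
    adj?  : ∀ u v → Dec (Adj u v)
    sym   : ∀ {u v} → Adj u v → Adj v u
    irrefl : ∀ {u} → ¬ Adj u u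

module _ (G : Graph) where
  open Graph G

  V : Set
  V = Fin n

  IsPath : V → V → List V → Set
  IsPath x y ps = Linked Adj ps × Unique ps × head ps ≡ just x × last ps ≡ just y

  IsChordlessPath : V → V → List V → Set
  IsChordlessPath x y ps =
    IsPath x y ps ×
    (∀ (i j : Fin (length ps)) → toℕ i + 2 ≤ toℕ j → ¬ Adj (lookup ps i) (lookup ps j))

  Avoids : List V → V → Set
  Avoids ps v = All (λ w → ¬ Adj v w) ps

  Connected : Set
  Connected = ∀ (u v : V) → ∃[ ps ] IsPath u v ps

  IsClaw : V → V → V → V → Set
  IsClaw c a b d =
    Adj c a × Adj c b × Adj c d ×
    a ≢ b × a ≢ d × b ≢ d ×
    ¬ Adj a b × ¬ Adj a d × ¬ Adj b d

  ClawFree : Set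
  ClawFree = ∀ c a b d → ¬ IsClaw c a b d

  IsAsteroidalTriple : V → V → V → Set
  IsAsteroidalTriple a b c =
    a ≢ b × a ≢ c × b ≢ c ×
    ¬ Adj a b × ¬ Adj a c × ¬ Adj b c ×
    (∃[ ps ] IsPath a b ps × Avoids ps c) ×
    (∃[ ps ] IsPath a c ps × Avoids ps b) ×
    (∃[ ps ] IsPath b c ps × Avoids ps a)

  ATFree : Set
  ATFree = ∀ a b c → ¬ IsAsteroidalTriple a b c

  InDominationBetweenness : V → V → V → Set
  InDominationBetweenness x y z =
    x ≢ y × x ≢ z × y ≢ z ×
    (∃[ ps ] IsChordlessPath x y ps × Avoids ps z) ×
    (∃[ ps ] IsChordlessPath y z ps × Avoids ps x)

  Admissible : V → Set
  Admissible y = ∀ x z → ¬ InDominationBetweenness x y z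

  -- A state is the list
  -- `out` of vertices visited so far (= enqueued, in order) together with
  -- the number k of vertices already dequeued and processed; the queue is
  -- the suffix of `out` after position k.  Processing the front vertex
  -- out[k] appends all its not-yet-visited neighbours, in an arbitrary
  -- order (arbitrary tie-breaking).
  data BFSRun (s : V) : List V → ℕ → Set where
    start : BFSRun s (s ∷ []) 0
    step  : ∀ {out k} → BFSRun s out k →
            (k<len : k < length out) →
            (ns : List V) → Unique ns →
            (∀ u → u ∈ ns ⇔ (Adj (lookup out (Data.Fin.fromℕ< k<len)) u × u ∉ out)) →
            BFSRun s (out ++ ns) (suc k)

  -- σ is a BFS order of G: the visit order of a completed BFS run
  -- (queue empty) started at some vertex s.
  IsBFSOrder : List V → Set
  IsBFSOrder σ = ∃[ s ] BFSRun s σ (length σ)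

module Submission where

-- A completed BFS run from s yields a *layering*: a level function (the BFS
-- distance from s) and a parent function such that every vertex v ≠ s has a
-- parent one level below adjacent to it, adjacent vertices differ in level by
-- at most one, and the last vertex y has maximum level.  Hence if
--     (x , y , z) lay in the domination betweenness, x and z would both reach
--     s avoiding y, and x, y, z would be an asteroidal triple.
--   * BFS: an invariant of the queue-based BFS shows that a completed run of a
--     connected graph is a layering whose maximum is its last vertex.

open import Defs
open import Data.List using (last)
open import Data.Maybe using (just)
open import Relation.Binary.PropositionalEquality using (_≡_)

open import Data.Nat using (ℕ; zero; suc; _+_; _≤_; _<_; z≤n; s≤s; s≤s⁻¹)
open import Data.Nat.Properties
  using (≤-trans; ≤-refl; ≤-reflexive; 1+n≰n; <⇒≱; n≤0⇒n≡0; m≤n⇒m≤1+n; n≤1+n; +-comm)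
open import Data.Fin using (Fin; fromℕ<) renaming (_≟_ to _≟F_)
open import Data.List using (List; []; _∷_; _++_; length; lookup; head)
open import Data.List.Properties using (++-assoc; ++-identityʳ; length-++)
open import Data.List.Membership.Propositional using (_∈_; _∉_)
open import Data.List.Membership.Propositional.Properties using (∈-++⁺ˡ; ∈-++⁺ʳ; ∈-++⁻; ∈-∃++)
import Data.List.Membership.DecPropositional as DecMembership
open import Data.List.Relation.Unary.Any using (here; there)
open import Data.List.Relation.Unary.All as All using (All; []; _∷_)
open import Data.List.Relation.Unary.All.Properties using (¬Any⇒All¬; ++⁻ʳ)
open import Data.List.Relation.Unary.AllPairs using ([]; _∷_)
open import Data.List.Relation.Unary.Linked using (Linked; []; [-]; _∷_)
open import Data.List.Relation.Unary.Unique.Propositional using (Unique)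
open import Data.Product using (Σ; _×_; ∃₂; ∃-syntax; _,_; proj₁; proj₂)
open import Data.Sum using (_⊎_; inj₁; inj₂)
open import Data.Empty using (⊥; ⊥-elim)
open import Relation.Nullary using (¬_; Dec; yes; no)
open import Relation.Binary.PropositionalEquality
  using (_≢_; refl; cong; subst; trans; module ≡-Reasoning) renaming (sym to ≡-sym)
open import Function.Bundles using (_⇔_; Equivalence)

module ListFacts {A : Set} where

  last-∈ : ∀ (xs : List A) {y} → last xs ≡ just y → y ∈ xs
  last-∈ (x ∷ []) refl = here refl
  last-∈ (x ∷ x' ∷ xs) e = there (last-∈ (x' ∷ xs) e)

  head-∈ : ∀ (xs : List A) {y} → head xs ≡ just y → y ∈ xs
  head-∈ (x ∷ xs) refl = here refl

  last-++-∷ : ∀ (xs : List A) w ws → last (xs ++ w ∷ ws) ≡ last (w ∷ ws)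
  last-++-∷ [] w ws = refl
  last-++-∷ (x ∷ []) w ws = refl
  last-++-∷ (x ∷ x' ∷ xs) w ws = last-++-∷ (x' ∷ xs) w ws

  last-++ : ∀ (xs ys : List A) {y} → last (xs ++ ys) ≡ just y →
            (ys ≡ [] × last xs ≡ just y) ⊎ y ∈ ys
  last-++ xs [] e = inj₁ (refl , trans (cong last (≡-sym (++-identityʳ xs))) e)
  last-++ xs (w ∷ ws) e = inj₂ (last-∈ (w ∷ ws) (trans (≡-sym (last-++-∷ xs w ws)) e))

  linked-suffix : ∀ {R : A → A → Set} (as : List A) {bs} → Linked R (as ++ bs) → Linked R bs
  linked-suffix [] l = l
  linked-suffix (a ∷ []) {[]} l = []
  linked-suffix (a ∷ []) {b ∷ bs} (_ ∷ l) = l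
  linked-suffix (a ∷ a' ∷ as) (_ ∷ l) = linked-suffix (a' ∷ as) l

  unique-suffix : ∀ (as : List A) {bs} → Unique (as ++ bs) → Unique bs
  unique-suffix [] u = u
  unique-suffix (a ∷ as) (_ ∷ u) = unique-suffix as u

  lookup-middle : ∀ (out : List A) {k} (p : k < length out) D u Q →
                  out ≡ D ++ u ∷ Q → length D ≡ k → lookup out (fromℕ< p) ≡ u
  lookup-middle _ (s≤s z≤n) [] u Q refl refl = refl
  lookup-middle _ (s≤s p) (d ∷ D) u Q refl refl = lookup-middle (D ++ u ∷ Q) p D u Q refl refl

  length-∷ʳ : ∀ (D : List A) u → length (D ++ u ∷ []) ≡ suc (length D)
  length-∷ʳ D u = trans (length-++ D) (+-comm (length D) 1)

  ++-length-≡ : ∀ (xs ys : List A) → length (xs ++ ys) ≡ length xs → ys ≡ []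
  ++-length-≡ [] [] e = refl
  ++-length-≡ (x ∷ xs) ys e = ++-length-≡ xs ys (cong Data.Nat.pred e)

  module _ (_≟_ : (x y : A) → Dec (x ≡ y)) {B : Set} where
    open DecMembership _≟_ using (_∈?_)

    override : List A → B → (A → B) → A → B
    override ns b f w with w ∈? ns
    ... | yes _ = b
    ... | no _ = f w

    override-∈ : ∀ ns (b : B) f {w} → w ∈ ns → override ns b f w ≡ b
    override-∈ ns b f {w} w∈ with w ∈? ns
    ... | yes _ = refl
    ... | no w∉ = ⊥-elim (w∉ w∈)

    override-∉ : ∀ ns (b : B) f {w} → w ∉ ns → override ns b f w ≡ f w
    override-∉ ns b f {w} w∉ with w ∈? ns
    ... | yes w∈ = ⊥-elim (w∉ w∈)
    ... | no _ = refl

open ListFacts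

module Walks (G : Graph) where
  open Graph G renaming (sym to adj-sym)
  open DecMembership (_≟F_ {n}) using (_∈?_)

  data Walk (P : Fin n → Set) : Fin n → Fin n → Set where
    wnil  : ∀ {u} → P u → Walk P u u
    wcons : ∀ {u v w} → P u → Adj u v → Walk P v w → Walk P u w

  module _ {P : Fin n → Set} where
    walk-end : ∀ {u v} → Walk P u v → P v
    walk-end (wnil p) = p
    walk-end (wcons _ _ w) = walk-end w

    _++ʷ_ : ∀ {u v w} → Walk P u v → Walk P v w → Walk P u w
    wnil _ ++ʷ w' = w'
    wcons p a w ++ʷ w' = wcons p a (w ++ʷ w')

    walk-snoc : ∀ {u v w} → Walk P u v → Adj v w → P w → Walk P u w
    walk-snoc w a p = w ++ʷ wcons (walk-end w) a (wnil p)

    walk-reverse : ∀ {u v} → Walk P u v → Walk P v u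
    walk-reverse (wnil p) = wnil p
    walk-reverse (wcons p a w) = walk-snoc (walk-reverse w) (adj-sym a) p

    -- every walk inside P shortens to a path inside P: prepending u to the
    -- path of the tail either keeps it a path or, if u already occurs on it,
    -- we cut the path back to that occurrence
    walk→path : ∀ {u v} → Walk P u v → ∃[ ps ] IsPath G u v ps × All P ps
    walk→path {u} (wnil p) = (u ∷ []) , ([-] , ([] ∷ []) , refl , refl) , (p ∷ [])
    walk→path {u} (wcons {v = v} p a w) with walk→path w
    ... | [] , (_ , _ , () , _) , _
    ... | (v' ∷ ps) , (lk , uq , refl , la) , al with u ∈? (v ∷ ps)
    ...   | no u∉ = (u ∷ v ∷ ps) , ((a ∷ lk) , (¬Any⇒All¬ (v ∷ ps) u∉ ∷ uq) , refl , la) , (p ∷ al)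
    ...   | yes u∈ with ∈-∃++ u∈
    ...     | as , bs , eq =
              (u ∷ bs) ,
              ( linked-suffix as (subst (Linked Adj) eq lk)
              , unique-suffix as (subst Unique eq uq)
              , refl
              , trans (≡-sym (last-++-∷ as u bs)) (trans (cong last (≡-sym eq)) la) )
              , ++⁻ʳ as (subst (All P) eq al)

module Layerings (G : Graph) where
  open Graph G renaming (sym to adj-sym)
  open Walks G

  -- level plays the role of the distance from s, parent that of a BFS-tree
  -- parent; only the stated local conditions are used
  record Layering (s y : Fin n) : Set where
    field
      level        : Fin n → ℕ
      parent       : Fin n → Fin n
      level-root   : level s ≡ 0
      parent-adj   : ∀ v → v ≢ s → Adj (parent v) v
      parent-level : ∀ v → v ≢ s → suc (level (parent v)) ≡ level v
      level-edge   : ∀ {u v} → Adj u v → level v ≤ suc (level u)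
      level-max    : ∀ v → level v ≤ level y

  module LayeringFacts {s y : Fin n} (L : Layering s y) where
    open Layering L

    far⇒distinct : ∀ {u v} → 2 + level u ≤ level v → u ≢ v
    far⇒distinct le refl = 1+n≰n (≤-trans (n≤1+n _) le)

    far⇒nonadjacent : ∀ {u v} → 2 + level u ≤ level v → ¬ Adj u v
    far⇒nonadjacent le a = <⇒≱ le (level-edge a)

    grandparent : Fin n → Fin n
    grandparent v = parent (parent v)

    grandparent-level : ∀ {v} → v ≢ s → parent v ≢ s → 2 + level (grandparent v) ≤ level v
    grandparent-level v≢s pv≢s =
      ≤-reflexive (trans (cong suc (parent-level _ pv≢s)) (parent-level _ v≢s))

    level-zero⇒root : ∀ v → level v ≡ 0 → v ≡ s
    level-zero⇒root v lv≡0 with v ≟F s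
    ... | yes v≡s = v≡s
    ... | no v≢s with trans (parent-level v v≢s) lv≡0
    ...   | ()

    -- if the root is adjacent to y, all levels are ≤ 1 and the root
    -- is adjacent to every other vertex
    root-dominates : Adj s y → ∀ b → b ≢ s → Adj s b
    root-dominates sy b b≢s = subst (λ p → Adj p b) parent≡s (parent-adj b b≢s)
      where
      level-b≤1 : suc (level (parent b)) ≤ 1
      level-b≤1 = ≤-trans (≤-reflexive (parent-level b b≢s))
                    (≤-trans (level-max b) (≤-trans (level-edge sy) (≤-reflexive (cong suc level-root))))
      parent≡s : parent b ≡ s
      parent≡s = level-zero⇒root (parent b) (n≤0⇒n≡0 (s≤s⁻¹ level-b≤1))

    Avoiding : Fin n → Set
    Avoiding w = ¬ Adj y w

    -- following parents from a non-neighbour v of y either reaches s avoiding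
    -- y, or v's parent is a neighbour of y; a neighbour of y further up the
    -- parent chain would be two levels below v, contradicting maximality of y
    escape : ∀ v → ¬ Adj y v → Walk Avoiding s v ⊎ (v ≢ s × Adj y (parent v))
    escape v = go (level v) v refl
      where
      go : ∀ k v → level v ≡ k → ¬ Adj y v → Walk Avoiding s v ⊎ (v ≢ s × Adj y (parent v))
      go k v lv≡k nyv with v ≟F s
      ... | yes refl = inj₁ (wnil nyv)
      ... | no v≢s with adj? y (parent v)
      ...   | yes ypv = inj₂ (v≢s , ypv)
      ...   | no nypv with k | trans (parent-level v v≢s) lv≡k
      ...     | zero | ()
      ...     | suc k | lpv≡k with go k (parent v) (cong Data.Nat.pred lpv≡k) nypv
      ...       | inj₁ walk = inj₁ (walk-snoc walk (parent-adj v v≢s) nyv)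
      ...       | inj₂ (pv≢s , ygv) =
                  ⊥-elim (far⇒nonadjacent (≤-trans (grandparent-level v≢s pv≢s) (level-max v))
                                          (adj-sym ygv))

    claw-at-root : ∀ {a b} → a ≢ s → parent a ≡ s → Adj y (parent a) → a ≢ y → ¬ Adj y a →
                   b ≢ y → ¬ Adj y b → a ≢ b → ¬ Adj a b → IsClaw G s a y b
    claw-at-root {a} {b} a≢s pa≡s ypa a≢y nya b≢y nyb a≢b nab =
      sa , sy , root-dominates sy b b≢s , a≢y , a≢b , (λ e → b≢y (≡-sym e)) ,
      (λ ay → nya (adj-sym ay)) , nab , nyb
      where
      sa : Adj s a
      sa = subst (λ p → Adj p a) pa≡s (parent-adj a a≢s)
      sy : Adj s y
      sy = subst (λ p → Adj p y) pa≡s (adj-sym ypa)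
      b≢s : b ≢ s
      b≢s refl = nyb (adj-sym sy)

    -- a non-neighbour a of y whose parent p ≠ s is a neighbour of y forms a
    -- claw at p with y and the grandparent of a, two levels below a
    claw-at-parent : ∀ {a} → a ≢ s → parent a ≢ s → Adj y (parent a) → a ≢ y → ¬ Adj y a →
                     IsClaw G (parent a) a y (grandparent a)
    claw-at-parent {a} a≢s pa≢s ypa a≢y nya =
      parent-adj a a≢s , adj-sym ypa , adj-sym (parent-adj (parent a) pa≢s) ,
      a≢y , (λ e → far⇒distinct ga (≡-sym e)) , (λ e → far⇒distinct gy (≡-sym e)) ,
      (λ ay → nya (adj-sym ay)) , (λ at → far⇒nonadjacent ga (adj-sym at)) ,
      (λ yt → far⇒nonadjacent gy (adj-sym yt))
      where
      ga : 2 + level (grandparent a) ≤ level a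
      ga = grandparent-level a≢s pa≢s
      gy : 2 + level (grandparent a) ≤ level y
      gy = ≤-trans ga (level-max a)

    parent-not-neighbour : ClawFree G → ∀ {a b} → a ≢ s → Adj y (parent a) →
                           a ≢ y → ¬ Adj y a → b ≢ y → ¬ Adj y b → a ≢ b → ¬ Adj a b → ⊥
    parent-not-neighbour cf {a} {b} a≢s ypa a≢y nya b≢y nyb a≢b nab with parent a ≟F s
    ... | yes pa≡s = cf s a y b (claw-at-root a≢s pa≡s ypa a≢y nya b≢y nyb a≢b nab)
    ... | no pa≢s = cf (parent a) a y (grandparent a) (claw-at-parent a≢s pa≢s ypa a≢y nya)

    admissible : ClawFree G → ATFree G → Admissible G y
    admissible cf atf x z (x≢y , x≢z , y≢z , (P , (pathP , _) , avP) , (Q , (pathQ , _) , avQ)) =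
      combine (escape x nyx) (escape z nyz)
      where
      nxy : ¬ Adj x y
      nxy = All.lookup avQ (head-∈ Q (proj₁ (proj₂ (proj₂ pathQ))))
      nyx : ¬ Adj y x
      nyx a = nxy (adj-sym a)
      nyz : ¬ Adj y z
      nyz a = All.lookup avP (last-∈ P (proj₂ (proj₂ (proj₂ pathP)))) (adj-sym a)
      nxz : ¬ Adj x z
      nxz = All.lookup avQ (last-∈ Q (proj₂ (proj₂ (proj₂ pathQ))))
      combine : Walk Avoiding s x ⊎ (x ≢ s × Adj y (parent x)) →
                Walk Avoiding s z ⊎ (z ≢ s × Adj y (parent z)) → ⊥
      combine (inj₂ (x≢s , ypx)) _ =
        parent-not-neighbour cf x≢s ypx x≢y nyx (λ e → y≢z (≡-sym e)) nyz x≢z nxz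
      combine (inj₁ _) (inj₂ (z≢s , ypz)) =
        parent-not-neighbour cf z≢s ypz (λ e → y≢z (≡-sym e)) nyz x≢y nyx
                             (λ e → x≢z (≡-sym e)) (λ a → nxz (adj-sym a))
      combine (inj₁ sx) (inj₁ sz) with walk→path (walk-reverse sx ++ʷ sz)
      ... | R , pathR , avR =
            atf x y z (x≢y , x≢z , y≢z , nxy , nxz , nyz , (P , pathP , avP) , (R , pathR , avR) , (Q , pathQ , avQ))

module BreadthFirstSearch (G : Graph) (s : Fin (Graph.n G)) where
  open Graph G renaming (sym to adj-sym)
  open Layerings G
  open DecMembership (_≟F_ {n}) using (_∈?_)

  -- Invariant of a BFS state (out , k): out = done ++ current ++ next, where
  -- done are the k processed vertices, current the queued vertices of the
  -- current layer and next the queued vertices of the following layer.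
  -- level and parent record the BFS tree built so far.
  record BFSState (out : List (Fin n)) (k : ℕ) : Set where
    field
      level         : Fin n → ℕ
      parent        : Fin n → Fin n
      layer         : ℕ
      done current next : List (Fin n)
      split         : out ≡ done ++ current ++ next
      done-length   : length done ≡ k
      done-level    : ∀ {v} → v ∈ done → level v ≤ layer
      current-level : ∀ {v} → v ∈ current → level v ≡ layer
      next-level    : ∀ {v} → v ∈ next → level v ≡ suc layer
      done-closed   : ∀ {u v} → u ∈ done → Adj u v → v ∈ out
      done-edge     : ∀ {u v} → u ∈ done → v ∈ out → Adj u v → level v ≤ suc (level u)
      root-visited  : s ∈ out
      level-root    : level s ≡ 0
      parent-ok     : ∀ {v} → v ∈ out → v ≢ s →
                      parent v ∈ out × Adj (parent v) v × suc (level (parent v)) ≡ level v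
      last-max      : ∀ {y} → last out ≡ just y → ∀ {v} → v ∈ out → level v ≤ level y

  initial : BFSState (s ∷ []) 0
  initial = record
    { level = λ _ → 0 ; parent = λ _ → s ; layer = 0
    ; done = [] ; current = s ∷ [] ; next = []
    ; split = refl ; done-length = refl
    ; done-level = λ () ; current-level = λ _ → refl ; next-level = λ ()
    ; done-closed = λ () ; done-edge = λ ()
    ; root-visited = here refl ; level-root = refl
    ; parent-ok = λ { (here refl) s≢s → ⊥-elim (s≢s refl) }
    ; last-max = λ _ _ → z≤n
    }

  module StateFacts {out k} (S : BFSState out k) where
    open BFSState S

    done⊆out : ∀ {v} → v ∈ done → v ∈ out
    done⊆out v∈ = subst (_ ∈_) (≡-sym split) (∈-++⁺ˡ v∈)

    current⊆out : ∀ {v} → v ∈ current → v ∈ out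
    current⊆out v∈ = subst (_ ∈_) (≡-sym split) (∈-++⁺ʳ done (∈-++⁺ˡ v∈))

    level-bound : ∀ {v} → v ∈ out → level v ≤ suc layer
    level-bound v∈ with ∈-++⁻ done (subst (_ ∈_) split v∈)
    ... | inj₁ d = m≤n⇒m≤1+n (done-level d)
    ... | inj₂ q with ∈-++⁻ current q
    ...   | inj₁ q₁ = m≤n⇒m≤1+n (≤-reflexive (current-level q₁))
    ...   | inj₂ q₂ = ≤-reflexive (next-level q₂)

  next-layer : ∀ {out k} (S : BFSState out k) → BFSState.current S ≡ [] →
               Σ (BFSState out k) (λ S' → BFSState.current S' ≡ BFSState.next S)
  next-layer {out} S current≡[] = S' , refl
    where
    open BFSState S
    S' : BFSState out _
    S' = record
      { level = level ; parent = parent ; layer = suc layer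
      ; done = done ; current = next ; next = []
      ; split = trans split (trans (cong (λ q → done ++ q ++ next) current≡[])
                                   (cong (done ++_) (≡-sym (++-identityʳ next))))
      ; done-length = done-length
      ; done-level = λ d → m≤n⇒m≤1+n (done-level d)
      ; current-level = next-level ; next-level = λ ()
      ; done-closed = done-closed ; done-edge = done-edge
      ; root-visited = root-visited ; level-root = level-root
      ; parent-ok = parent-ok ; last-max = last-max }

  front : ∀ {out k} (S : BFSState out k) → k < length out →
          Σ (BFSState out k) (λ S' → ∃₂ λ u rest → BFSState.current S' ≡ u ∷ rest)
  front {out} {k} S k<len with BFSState.current S in current≡
  ... | u ∷ rest = S , u , rest , current≡
  ... | [] with next-layer S current≡ | BFSState.next S in next≡
  ...   | S' , current'≡ | u ∷ rest = S' , u , rest , trans current'≡ next≡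
  ...   | S' , _ | [] = ⊥-elim (1+n≰n (≤-trans k<len (≤-reflexive length≡k)))
    where
    open BFSState S
    length≡k : length out ≡ k
    length≡k = trans (cong length split)
                 (trans (cong (λ q → length (done ++ q))
                              (trans (cong (_++ next) current≡) next≡))
                        (trans (cong length (++-identityʳ done)) done-length))

  module Process {out k} (S : BFSState out k) (u : Fin n) (rest : List (Fin n))
                 (current≡ : BFSState.current S ≡ u ∷ rest)
                 (k<len : k < length out) (ns : List (Fin n))
                 (ns-spec : ∀ w → w ∈ ns ⇔ (Adj (lookup out (fromℕ< k<len)) w × w ∉ out)) where
    open BFSState S
    open StateFacts S

    split-at-u : out ≡ done ++ u ∷ (rest ++ next)
    split-at-u = trans split (cong (λ q → done ++ q ++ next) current≡)

    front≡u : lookup out (fromℕ< k<len) ≡ u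
    front≡u = lookup-middle out k<len done u (rest ++ next) split-at-u done-length

    ns-sound : ∀ {w} → w ∈ ns → Adj u w × w ∉ out
    ns-sound {w} w∈ with Equivalence.to (ns-spec w) w∈
    ... | a , w∉ = subst (λ x → Adj x w) front≡u a , w∉

    ns-complete : ∀ {w} → Adj u w → w ∉ out → w ∈ ns
    ns-complete {w} a w∉ = Equivalence.from (ns-spec w) (subst (λ x → Adj x w) (≡-sym front≡u) a , w∉)

    u∈current : u ∈ current
    u∈current = subst (u ∈_) (≡-sym current≡) (here refl)

    u∈out : u ∈ out
    u∈out = current⊆out u∈current

    level-u : level u ≡ layer
    level-u = current-level u∈current

    out∉ns : ∀ {w} → w ∈ out → w ∉ ns
    out∉ns w∈ w∈ns = proj₂ (ns-sound w∈ns) w∈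

    level' : Fin n → ℕ
    level' = override _≟F_ ns (suc layer) level

    parent' : Fin n → Fin n
    parent' = override _≟F_ ns u parent

    level'-old : ∀ {w} → w ∈ out → level' w ≡ level w
    level'-old w∈ = override-∉ _≟F_ ns (suc layer) level (out∉ns w∈)

    level'-new : ∀ {w} → w ∈ ns → level' w ≡ suc layer
    level'-new w∈ = override-∈ _≟F_ ns (suc layer) level w∈

    done' : List (Fin n)
    done' = done ++ u ∷ []

    done'⊆out : ∀ {v} → v ∈ done' → v ∈ out
    done'⊆out v∈ with ∈-++⁻ done v∈
    ... | inj₁ d = done⊆out d
    ... | inj₂ (here refl) = u∈out

    out' : List (Fin n)
    out' = out ++ ns

    split' : out' ≡ done' ++ rest ++ (next ++ ns)
    split' = begin
      out ++ ns                           ≡⟨ cong (_++ ns) split-at-u ⟩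
      (done ++ u ∷ (rest ++ next)) ++ ns  ≡⟨ ++-assoc done (u ∷ (rest ++ next)) ns ⟩
      done ++ u ∷ ((rest ++ next) ++ ns)  ≡⟨ cong (λ q → done ++ u ∷ q) (++-assoc rest next ns) ⟩
      done ++ u ∷ (rest ++ next ++ ns)    ≡⟨ ++-assoc done (u ∷ []) (rest ++ next ++ ns) ⟨
      done' ++ rest ++ (next ++ ns)       ∎
      where open ≡-Reasoning

    done-level' : ∀ {v} → v ∈ done' → level' v ≤ layer
    done-level' v∈ with ∈-++⁻ done v∈
    ... | inj₁ d = subst (_≤ layer) (≡-sym (level'-old (done⊆out d))) (done-level d)
    ... | inj₂ (here refl) = ≤-reflexive (trans (level'-old u∈out) level-u)

    current-level' : ∀ {v} → v ∈ rest → level' v ≡ layer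
    current-level' v∈ = trans (level'-old (current⊆out q)) (current-level q)
      where q = subst (_ ∈_) (≡-sym current≡) (there v∈)

    next-level' : ∀ {v} → v ∈ next ++ ns → level' v ≡ suc layer
    next-level' {v} v∈ with ∈-++⁻ next v∈
    ... | inj₁ q = trans (level'-old (subst (_ ∈_) (≡-sym split) (∈-++⁺ʳ done (∈-++⁺ʳ current q))))
                         (next-level q)
    ... | inj₂ m = level'-new m

    done-closed' : ∀ {a v} → a ∈ done' → Adj a v → v ∈ out'
    done-closed' {a} {v} a∈ adj with ∈-++⁻ done a∈
    ... | inj₁ d = ∈-++⁺ˡ (done-closed d adj)
    ... | inj₂ (here refl) with v ∈? out
    ...   | yes v∈ = ∈-++⁺ˡ v∈
    ...   | no v∉ = ∈-++⁺ʳ out (ns-complete adj v∉)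

    done-edge' : ∀ {a v} → a ∈ done' → v ∈ out' → Adj a v → level' v ≤ suc (level' a)
    done-edge' {a} {v} a∈ v∈ adj rewrite level'-old (done'⊆out a∈) with ∈-++⁻ out v∈ | ∈-++⁻ done a∈
    ... | inj₁ vo | inj₁ d = subst (_≤ suc (level a)) (≡-sym (level'-old vo)) (done-edge d vo adj)
    ... | inj₁ vo | inj₂ (here refl) rewrite level'-old vo | level-u = level-bound vo
    ... | inj₂ vn | inj₁ d = ⊥-elim (proj₂ (ns-sound vn) (done-closed d adj))
    ... | inj₂ vn | inj₂ (here refl) rewrite level'-new vn | level-u = ≤-refl

    parent-ok' : ∀ {v} → v ∈ out' → v ≢ s →
                 parent' v ∈ out' × Adj (parent' v) v × suc (level' (parent' v)) ≡ level' v
    parent-ok' {v} v∈ v≢s with ∈-++⁻ out v∈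
    ... | inj₁ vo with parent-ok vo v≢s
    ...   | p∈ , adj , lp
            rewrite override-∉ _≟F_ ns u parent (out∉ns vo) | level'-old vo | level'-old p∈ =
            ∈-++⁺ˡ p∈ , adj , lp
    parent-ok' {v} v∈ v≢s | inj₂ vn
      rewrite override-∈ _≟F_ ns u parent vn | level'-new vn | level'-old u∈out | level-u =
      ∈-++⁺ˡ u∈out , proj₁ (ns-sound vn) , refl

    -- the new last vertex is old and maximal, or new and on the top layer
    last-max' : ∀ {y} → last out' ≡ just y → ∀ {v} → v ∈ out' → level' v ≤ level' y
    last-max' {y} ly {v} v∈ with last-++ out ns ly | ∈-++⁻ out v∈
    ... | inj₁ (refl , lo) | inj₁ vo rewrite level'-old vo | level'-old (last-∈ out lo) = last-max lo vo
    ... | inj₂ yn | inj₁ vo rewrite level'-new yn | level'-old vo = level-bound vo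
    ... | inj₂ yn | inj₂ vn rewrite level'-new yn | level'-new vn = ≤-refl

    processed : BFSState out' (suc k)
    processed = record
      { level = level' ; parent = parent' ; layer = layer
      ; done = done' ; current = rest ; next = next ++ ns
      ; split = split' ; done-length = trans (length-∷ʳ done u) (cong suc done-length)
      ; done-level = done-level' ; current-level = current-level' ; next-level = next-level'
      ; done-closed = done-closed' ; done-edge = done-edge'
      ; root-visited = ∈-++⁺ˡ root-visited ; level-root = trans (level'-old root-visited) level-root
      ; parent-ok = parent-ok' ; last-max = last-max' }

  run-state : ∀ {out k} → BFSRun G s out k → BFSState out k
  run-state start = initial
  run-state (step r k<len ns _ ns-spec) with front (run-state r) k<len
  ... | S , u , rest , current≡ = Process.processed S u rest current≡ k<len ns ns-spec

  -- a completed run of a connected graph visits every vertex, all of them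
  -- processed, so its levels and parents form a layering with maximum y
  completed-layering : Connected G → ∀ {σ} → BFSState σ (length σ) →
                       ∀ {y} → last σ ≡ just y → Layering s y
  completed-layering conn {σ} S {y} ly = record
    { level = level ; parent = parent ; level-root = level-root
    ; parent-adj = λ v v≢s → proj₁ (proj₂ (parent-ok (visited v) v≢s))
    ; parent-level = λ v v≢s → proj₂ (proj₂ (parent-ok (visited v) v≢s))
    ; level-edge = λ {a} {v} adj → done-edge (processed (visited a)) (visited v) adj
    ; level-max = λ v → last-max ly (visited v) }
    where
    open BFSState S
    queue-empty : current ++ next ≡ []
    queue-empty = ++-length-≡ done (current ++ next)
                    (trans (≡-sym (cong length split)) (≡-sym done-length))
    processed : ∀ {v} → v ∈ σ → v ∈ done
    processed v∈ with ∈-++⁻ done (subst (_ ∈_) split v∈)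
    ... | inj₁ d = d
    ... | inj₂ q with subst (_ ∈_) queue-empty q
    ...   | ()
    -- a path starting inside σ stays inside σ, since σ is closed under neighbours
    path-visited : ∀ (ps : List (Fin n)) {a} → Linked Adj ps → head ps ≡ just a → a ∈ σ → All (_∈ σ) ps
    path-visited (_ ∷ []) [-] refl a∈ = a∈ ∷ []
    path-visited (_ ∷ b ∷ ps) (adj ∷ l) refl a∈ =
      a∈ ∷ path-visited (b ∷ ps) l refl (done-closed (processed a∈) adj)
    visited : ∀ v → v ∈ σ
    visited v with conn s v
    ... | ps , (l , _ , h , la) = All.lookup (path-visited ps l h root-visited) (last-∈ ps la)

lemma2 : (G : Graph) → Connected G → ClawFree G → ATFree G →
    ∀ σ → IsBFSOrder G σ → ∀ y → last σ ≡ just y → Admissible G y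
lemma2 G conn cf atf σ (s , run) y ly =
  Layerings.LayeringFacts.admissible G layering cf atf
  where
  open BreadthFirstSearch G s
  layering : Layerings.Layering G s y
  layering = completed-layering conn (run-state run) ly
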